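{- Let $q$ be a prime power and let $1\le t_1\le t_2$ be integers. The number of elements of the set $$S=\{(f_1,f_2)\mid f_1,f_2\in\mathbb{F}_q[X],\ \deg(f_1)\le t_1-1,\ \deg(f_2)\le t_2-1,\ (f_1,f_2)\text{ is in reduced form}\}$$ is $q^{t_1+t_2-1}+1$.
   Context: A pair of polynomials $(f_1,f_2)$ over $\mathbb{F}_q$ is in reduced form if the first non-zero polynomial among $f_1,f_2$ is monic and $\gcd(f_1,f_2)=1$ (gcd taken monic). The zero polynomial is allowed in $S$. -}

module Defs where

open import Level using (0ℓ)
open import Algebra.Bundles using (CommutativeRing)
open import Data.Nat using (ℕ)
open import Data.Product using (∃; Σ; _×_)
open import Data.List using (List; []; _∷_; _++_; [_]; length)
open import Data.List.Relation.Unary.All using (All)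
open import Data.List.Relation.Unary.Unique.Propositional using (Unique)
open import Data.List.Membership.Propositional using (_∈_)
open import Function.Bundles using (_⇔_)
open import Relation.Binary.PropositionalEquality using (_≡_)
open import Relation.Nullary using (¬_)

record Field : Set₁ where
  field
    commutativeRing : CommutativeRing 0ℓ 0ℓ
  open CommutativeRing commutativeRing public
  field
    ≈⇒≡     : ∀ {x y} → x ≈ y → x ≡ y
    0≢1     : ¬ (0# ≡ 1#)
    inverse : ∀ x → ¬ (x ≡ 0#) → ∃ λ y → x * y ≡ 1#

HasSize : {A : Set} → (A → Set) → ℕ → Set
HasSize {A} P n = ∃ λ (L : List A) → Unique L × length L ≡ n × (∀ a → (a ∈ L) ⇔ P a)

module Poly (F : Field) where
  open Field F

  -- Polynomials over F as coefficient lists, lowest degree first.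
  -- Trailing zero coefficients are allowed; equality of polynomials is _≐_.
  Pol : Set
  Pol = List Carrier

  IsZero : Pol → Set
  IsZero f = All (_≡ 0#) f

  _≐_ : Pol → Pol → Set
  [] ≐ g = IsZero g
  (a ∷ f) ≐ [] = IsZero (a ∷ f)
  (a ∷ f) ≐ (b ∷ g) = (a ≡ b) × (f ≐ g)

  infixl 6 _⊕_
  infixl 7 _⊛_ _·_

  _⊕_ : Pol → Pol → Pol
  [] ⊕ g = g
  (a ∷ f) ⊕ [] = a ∷ f
  (a ∷ f) ⊕ (b ∷ g) = (a + b) ∷ (f ⊕ g)

  _·_ : Carrier → Pol → Pol
  c · [] = []
  c · (a ∷ f) = (c * a) ∷ (c · f)

  _⊛_ : Pol → Pol → Pol
  [] ⊛ g = []
  (a ∷ f) ⊛ g = (a · g) ⊕ (0# ∷ (f ⊛ g))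

  _∣_ : Pol → Pol → Set
  d ∣ f = ∃ λ g → (d ⊛ g) ≐ f

  IsGCD : Pol → Pol → Pol → Set
  IsGCD g f₁ f₂ = (g ∣ f₁) × (g ∣ f₂) × (∀ d → d ∣ f₁ → d ∣ f₂ → d ∣ g)

  Monic : Pol → Set
  Monic f = ∃ λ p → f ≐ (p ++ [ 1# ])

  ReducedForm : Pol → Pol → Set
  ReducedForm f₁ f₂ =
    (¬ IsZero f₁ → Monic f₁) ×
    (IsZero f₁ → ¬ IsZero f₂ → Monic f₂) ×
    IsGCD [ 1# ] f₁ f₂

module Submission where

-- If f₁ = 0, coprimality forces f₂ to be a nonzero constant, so f₂ = 1 by monicity.
-- Otherwise f₁ is monic of some degree m < t₁, and division by f₁ writes f₂ = w f₁ + s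
-- with w arbitrary of degree < t₂ - m and s of degree < m coprime to f₁; hence the count
-- is 1 + Σ_{m<t₁} q^(t₂-m) B(m), where B(m) counts the coprime pairs (f monic of degree m,
-- r of degree < m).  One step of the Euclidean algorithm (r = c R with c ≠ 0 and R monic
-- of degree k < m, then f = Q R + s with Q monic of degree m - k) gives
-- B(m) = (q-1) Σ_{k<m} q^(m-k) B(k), so B(0) = 1, B(m) = (q-1) q^(2m-1) for m ≥ 1, and
-- the weighted sum collapses to q^(t₁+t₂-1).

open import Defs
open import Level using (0ℓ)
import Algebra.Properties.AbelianGroup as AbelianGroupProperties
import Algebra.Properties.CommutativeSemigroup as CommutativeSemigroupProperties
import Algebra.Properties.Ring as RingProperties
open import Data.Empty using (⊥-elim)
open import Data.Fin using (Fin; punchIn; punchOut)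
import Data.Fin as Fin
import Data.Fin.Properties as Fin
open import Data.List using (List; []; _∷_; _++_; [_]; length; map; tabulate; downFrom)
open import Data.List.Properties using (length-map; length-++; length-tabulate)
import Data.List.Properties as List
open import Data.List.Membership.Propositional using (_∈_)
open import Data.List.Membership.Propositional.Properties
  using (∈-map⁺; ∈-map⁻; ∈-++⁺ˡ; ∈-++⁺ʳ; ∈-++⁻; ∈-tabulate⁺; ∈-tabulate⁻; ∈-downFrom⁺; ∈-downFrom⁻)
open import Data.List.Relation.Unary.All using (All; []; _∷_)
import Data.List.Relation.Unary.All as All
open import Data.List.Relation.Unary.All.Properties using (All¬⇒¬Any)
open import Data.List.Relation.Unary.AllPairs using ([]; _∷_)
open import Data.List.Relation.Unary.Any using (here; there)
open import Data.List.Relation.Unary.Unique.Propositional using (Unique)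
import Data.List.Relation.Unary.Unique.Propositional.Properties as Unique
open import Data.Nat using (ℕ; zero; suc; _∸_; _^_; _<_; _≤_; s≤s; z≤n)
import Data.Nat as ℕ
open import Data.Nat.Induction using (<-rec)
open import Data.Nat.ListAction using (sum)
import Data.Nat.Properties as Nat
open import Data.Product using (∃; ∃₂; _×_; _,_; proj₁; proj₂)
open import Data.Sum using (_⊎_; inj₁; inj₂; [_,_]′)
open import Data.Unit using (⊤; tt)
open import Data.Vec using (Vec; toList; []; _∷_)
import Data.Vec as Vec
import Data.Vec.Properties as Vec
open import Function.Base using (_∘_; const)
open import Function.Bundles using (_↔_; _⇔_; mk⇔; Equivalence; Inverse)
import Function.Properties.Equivalence as ⇔
open import Relation.Binary.Bundles using (Setoid)
open import Relation.Binary.Definitions using (DecidableEquality)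
open import Relation.Binary.PropositionalEquality
  using (_≡_; _≢_; refl; sym; trans; cong; cong₂; subst; module ≡-Reasoning)
import Relation.Binary.Reasoning.Setoid
open import Relation.Nullary using (¬_; yes; no)

module Polynomials (F : Field) where
  open Field F using (Carrier; _≈_; _+_; _*_; -_; 0#; 1#; ≈⇒≡; 0≢1; inverse)
  module R = Field F
  open Poly F
  module ≈-Reasoning = Relation.Binary.Reasoning.Setoid R.setoid
  open CommutativeSemigroupProperties R.+-commutativeSemigroup using (interchange)
  open RingProperties R.ring using (-1*x≈-x)
  open AbelianGroupProperties R.+-abelianGroup using ()
    renaming (x∙y⁻¹≈ε⇒x≈y to x+-y≈0⇒x≈y; ∙-cancelˡ to +-cancelˡ)

  coef : Pol → ℕ → Carrier
  coef []      i       = 0#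
  coef (a ∷ f) zero    = a
  coef (a ∷ f) (suc i) = coef f i

  -- Equivalent to Defs' _≐_ (see ≐⇒≃ and ≃⇒≐), but stated pointwise, so that the ring laws
  -- for polynomials reduce to those of F.
  infix 4 _≃_
  record _≃_ (f g : Pol) : Set where
    constructor coefwise
    field coef-≈ : ∀ i → coef f i ≈ coef g i
  open _≃_ public

  ≃-setoid : Setoid 0ℓ 0ℓ
  ≃-setoid = record
    { Carrier = Pol
    ; _≈_ = _≃_
    ; isEquivalence = record
      { refl  = coefwise λ i → R.refl
      ; sym   = λ f≃g → coefwise λ i → R.sym (coef-≈ f≃g i)
      ; trans = λ f≃g g≃h → coefwise λ i → R.trans (coef-≈ f≃g i) (coef-≈ g≃h i)
      }
    }
  open Setoid ≃-setoid public using () renaming (refl to ≃-refl; sym to ≃-sym; trans to ≃-trans)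
  module ≃-Reasoning = Relation.Binary.Reasoning.Setoid ≃-setoid

  ≡⇒≃ : ∀ {f g} → f ≡ g → f ≃ g
  ≡⇒≃ refl = ≃-refl

  ∷-cong : ∀ {a b f g} → a ≈ b → f ≃ g → a ∷ f ≃ b ∷ g
  ∷-cong a≈b f≃g = coefwise λ { zero → a≈b ; (suc i) → coef-≈ f≃g i }

  ∷-injective : ∀ {a b f g} → a ∷ f ≃ b ∷ g → a ≈ b × f ≃ g
  ∷-injective eq = coef-≈ eq zero , coefwise (coef-≈ eq ∘ suc)

  ∷-≃[] : ∀ {a f} → a ≈ 0# → f ≃ [] → a ∷ f ≃ []
  ∷-≃[] a≈0 f≃0 = coefwise λ { zero → a≈0 ; (suc i) → coef-≈ f≃0 i }

  ∷-≃[]⁻ : ∀ {a f} → a ∷ f ≃ [] → a ≈ 0# × f ≃ []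
  ∷-≃[]⁻ eq = coef-≈ eq zero , coefwise (coef-≈ eq ∘ suc)

  IsZero⇒≃[] : ∀ {f} → IsZero f → f ≃ []
  IsZero⇒≃[] []              = ≃-refl
  IsZero⇒≃[] (a≡0 ∷ f-zero) = ∷-≃[] (R.reflexive a≡0) (IsZero⇒≃[] f-zero)

  ≃[]⇒IsZero : ∀ {f} → f ≃ [] → IsZero f
  ≃[]⇒IsZero {[]}    _     = []
  ≃[]⇒IsZero {a ∷ f} a∷f≃0 with a≈0 , f≃0 ← ∷-≃[]⁻ a∷f≃0 = ≈⇒≡ a≈0 ∷ ≃[]⇒IsZero f≃0

  ≐⇒≃ : ∀ {f g} → f ≐ g → f ≃ g
  ≐⇒≃ {[]}    {g}     g-zero         = ≃-sym (IsZero⇒≃[] g-zero)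
  ≐⇒≃ {a ∷ f} {[]}    f-zero         = IsZero⇒≃[] f-zero
  ≐⇒≃ {a ∷ f} {b ∷ g} (a≡b , f≐g) = ∷-cong (R.reflexive a≡b) (≐⇒≃ f≐g)

  ≃⇒≐ : ∀ {f g} → f ≃ g → f ≐ g
  ≃⇒≐ {[]}    {g}     f≃g = ≃[]⇒IsZero (≃-sym f≃g)
  ≃⇒≐ {a ∷ f} {[]}    f≃g = ≃[]⇒IsZero f≃g
  ≃⇒≐ {a ∷ f} {b ∷ g} f≃g = ≈⇒≡ (proj₁ (∷-injective f≃g)) , ≃⇒≐ (proj₂ (∷-injective f≃g))

  ≃⇒≡ : ∀ {f g} → length f ≡ length g → f ≃ g → f ≡ g
  ≃⇒≡ {[]}    {[]}    _   _   = refl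
  ≃⇒≡ {a ∷ f} {b ∷ g} len f≃g =
    cong₂ _∷_ (≈⇒≡ (proj₁ (∷-injective f≃g))) (≃⇒≡ (Nat.suc-injective len) (proj₂ (∷-injective f≃g)))

  coef-⊕ : ∀ f g i → coef (f ⊕ g) i ≈ coef f i + coef g i
  coef-⊕ []      g       i       = R.sym (R.+-identityˡ _)
  coef-⊕ (a ∷ f) []      i       = R.sym (R.+-identityʳ _)
  coef-⊕ (a ∷ f) (b ∷ g) zero    = R.refl
  coef-⊕ (a ∷ f) (b ∷ g) (suc i) = coef-⊕ f g i

  coef-· : ∀ c f i → coef (c · f) i ≈ c * coef f i
  coef-· c []      i       = R.sym (R.zeroʳ c)
  coef-· c (a ∷ f) zero    = R.refl
  coef-· c (a ∷ f) (suc i) = coef-· c f i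

  ⊕-cong : ∀ {f f' g g'} → f ≃ f' → g ≃ g' → f ⊕ g ≃ f' ⊕ g'
  ⊕-cong {f} {f'} {g} {g'} f≃f' g≃g' = coefwise λ i → begin
    coef (f ⊕ g) i            ≈⟨ coef-⊕ f g i ⟩
    coef f i + coef g i       ≈⟨ R.+-cong (coef-≈ f≃f' i) (coef-≈ g≃g' i) ⟩
    coef f' i + coef g' i     ≈⟨ coef-⊕ f' g' i ⟨
    coef (f' ⊕ g') i          ∎
    where open ≈-Reasoning

  ⊕-congˡ : ∀ {f g g'} → g ≃ g' → f ⊕ g ≃ f ⊕ g'
  ⊕-congˡ = ⊕-cong ≃-refl

  ⊕-comm : ∀ f g → f ⊕ g ≃ g ⊕ f
  ⊕-comm f g = coefwise λ i → begin
    coef (f ⊕ g) i       ≈⟨ coef-⊕ f g i ⟩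
    coef f i + coef g i  ≈⟨ R.+-comm _ _ ⟩
    coef g i + coef f i  ≈⟨ coef-⊕ g f i ⟨
    coef (g ⊕ f) i       ∎
    where open ≈-Reasoning

  ⊕-assoc : ∀ f g h → (f ⊕ g) ⊕ h ≃ f ⊕ (g ⊕ h)
  ⊕-assoc f g h = coefwise λ i → begin
    coef ((f ⊕ g) ⊕ h) i              ≈⟨ coef-⊕ (f ⊕ g) h i ⟩
    coef (f ⊕ g) i + coef h i         ≈⟨ R.+-congʳ (coef-⊕ f g i) ⟩
    (coef f i + coef g i) + coef h i  ≈⟨ R.+-assoc _ _ _ ⟩
    coef f i + (coef g i + coef h i)  ≈⟨ R.+-congˡ (coef-⊕ g h i) ⟨
    coef f i + coef (g ⊕ h) i         ≈⟨ coef-⊕ f (g ⊕ h) i ⟨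
    coef (f ⊕ (g ⊕ h)) i              ∎
    where open ≈-Reasoning

  ⊕-interchange : ∀ f g h k → (f ⊕ g) ⊕ (h ⊕ k) ≃ (f ⊕ h) ⊕ (g ⊕ k)
  ⊕-interchange f g h k = coefwise λ i → begin
    coef ((f ⊕ g) ⊕ (h ⊕ k)) i                        ≈⟨ coef-⊕ (f ⊕ g) (h ⊕ k) i ⟩
    coef (f ⊕ g) i + coef (h ⊕ k) i                   ≈⟨ R.+-cong (coef-⊕ f g i) (coef-⊕ h k i) ⟩
    (coef f i + coef g i) + (coef h i + coef k i)     ≈⟨ interchange _ _ _ _ ⟩
    (coef f i + coef h i) + (coef g i + coef k i)     ≈⟨ R.+-cong (coef-⊕ f h i) (coef-⊕ g k i) ⟨
    coef (f ⊕ h) i + coef (g ⊕ k) i                   ≈⟨ coef-⊕ (f ⊕ h) (g ⊕ k) i ⟨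
    coef ((f ⊕ h) ⊕ (g ⊕ k)) i                        ∎
    where open ≈-Reasoning

  ⊕-identityˡ : ∀ {z} f → z ≃ [] → z ⊕ f ≃ f
  ⊕-identityˡ {z} f z≃0 = coefwise λ i → begin
    coef (z ⊕ f) i       ≈⟨ coef-⊕ z f i ⟩
    coef z i + coef f i  ≈⟨ R.+-congʳ (coef-≈ z≃0 i) ⟩
    0# + coef f i        ≈⟨ R.+-identityˡ _ ⟩
    coef f i             ∎
    where open ≈-Reasoning

  ⊕-identityʳ : ∀ {z} f → z ≃ [] → f ⊕ z ≃ f
  ⊕-identityʳ {z} f z≃0 = ≃-trans (⊕-comm f z) (⊕-identityˡ f z≃0)

  0∷-⊕ : ∀ f g → 0# ∷ (f ⊕ g) ≃ (0# ∷ f) ⊕ (0# ∷ g)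
  0∷-⊕ f g = ∷-cong (R.sym (R.+-identityˡ 0#)) ≃-refl

  ·-cong : ∀ {c d f g} → c ≈ d → f ≃ g → c · f ≃ d · g
  ·-cong {c} {d} {f} {g} c≈d f≃g = coefwise λ i → begin
    coef (c · f) i   ≈⟨ coef-· c f i ⟩
    c * coef f i     ≈⟨ R.*-cong c≈d (coef-≈ f≃g i) ⟩
    d * coef g i     ≈⟨ coef-· d g i ⟨
    coef (d · g) i   ∎
    where open ≈-Reasoning

  ·-distribˡ : ∀ c f g → c · (f ⊕ g) ≃ c · f ⊕ c · g
  ·-distribˡ c f g = coefwise λ i → begin
    coef (c · (f ⊕ g)) i                ≈⟨ coef-· c (f ⊕ g) i ⟩
    c * coef (f ⊕ g) i                  ≈⟨ R.*-congˡ (coef-⊕ f g i) ⟩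
    c * (coef f i + coef g i)           ≈⟨ R.distribˡ c _ _ ⟩
    c * coef f i + c * coef g i         ≈⟨ R.+-cong (coef-· c f i) (coef-· c g i) ⟨
    coef (c · f) i + coef (c · g) i     ≈⟨ coef-⊕ (c · f) (c · g) i ⟨
    coef (c · f ⊕ c · g) i              ∎
    where open ≈-Reasoning

  ·-distribʳ : ∀ c d f → (c + d) · f ≃ c · f ⊕ d · f
  ·-distribʳ c d f = coefwise λ i → begin
    coef ((c + d) · f) i               ≈⟨ coef-· (c + d) f i ⟩
    (c + d) * coef f i                 ≈⟨ R.distribʳ _ c d ⟩
    c * coef f i + d * coef f i        ≈⟨ R.+-cong (coef-· c f i) (coef-· d f i) ⟨
    coef (c · f) i + coef (d · f) i    ≈⟨ coef-⊕ (c · f) (d · f) i ⟨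
    coef (c · f ⊕ d · f) i             ∎
    where open ≈-Reasoning

  ·-assoc : ∀ c d f → c · (d · f) ≃ (c * d) · f
  ·-assoc c d f = coefwise λ i → begin
    coef (c · (d · f)) i    ≈⟨ coef-· c (d · f) i ⟩
    c * coef (d · f) i      ≈⟨ R.*-congˡ (coef-· d f i) ⟩
    c * (d * coef f i)      ≈⟨ R.*-assoc c d _ ⟨
    (c * d) * coef f i      ≈⟨ coef-· (c * d) f i ⟨
    coef ((c * d) · f) i    ∎
    where open ≈-Reasoning

  ·-identityˡ : ∀ f → 1# · f ≃ f
  ·-identityˡ f = coefwise λ i → R.trans (coef-· 1# f i) (R.*-identityˡ _)

  ·-zeroˡ : ∀ f → 0# · f ≃ []
  ·-zeroˡ f = coefwise λ i → R.trans (coef-· 0# f i) (R.zeroˡ _)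

  ·-0∷ : ∀ c f → c · (0# ∷ f) ≃ 0# ∷ c · f
  ·-0∷ c f = ∷-cong (R.zeroʳ c) ≃-refl

  ⊛-zeroˡ : ∀ {f} g → f ≃ [] → f ⊛ g ≃ []
  ⊛-zeroˡ {[]}    g _ = ≃-refl
  ⊛-zeroˡ {a ∷ f} g a∷f≃0 with a≈0 , f≃0 ← ∷-≃[]⁻ a∷f≃0 = begin
    a · g ⊕ (0# ∷ f ⊛ g)  ≈⟨ ⊕-identityʳ (a · g) (∷-≃[] R.refl (⊛-zeroˡ g f≃0)) ⟩
    a · g                 ≈⟨ ·-cong a≈0 ≃-refl ⟩
    0# · g                ≈⟨ ·-zeroˡ g ⟩
    []                    ∎
    where open ≃-Reasoning

  ⊛-zeroʳ : ∀ f → f ⊛ [] ≃ []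
  ⊛-zeroʳ []      = ≃-refl
  ⊛-zeroʳ (a ∷ f) = ∷-≃[] R.refl (⊛-zeroʳ f)

  ⊛-congˡ : ∀ {f f'} g → f ≃ f' → f ⊛ g ≃ f' ⊛ g
  ⊛-congˡ {[]}    g f≃f' = ≃-sym (⊛-zeroˡ g (≃-sym f≃f'))
  ⊛-congˡ {a ∷ f} {[]}     g f≃f' = ⊛-zeroˡ g f≃f'
  ⊛-congˡ {a ∷ f} {b ∷ f'} g f≃f' =
    ⊕-cong (·-cong (proj₁ (∷-injective f≃f')) ≃-refl) (∷-cong R.refl (⊛-congˡ g (proj₂ (∷-injective f≃f'))))

  ⊛-congʳ : ∀ f {g g'} → g ≃ g' → f ⊛ g ≃ f ⊛ g'
  ⊛-congʳ []      g≃g' = ≃-refl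
  ⊛-congʳ (a ∷ f) g≃g' = ⊕-cong (·-cong R.refl g≃g') (∷-cong R.refl (⊛-congʳ f g≃g'))

  0∷-⊛ : ∀ f g → (0# ∷ f) ⊛ g ≃ 0# ∷ f ⊛ g
  0∷-⊛ f g = ⊕-identityˡ _ (·-zeroˡ g)

  ⊛-distribʳ : ∀ f f' g → (f ⊕ f') ⊛ g ≃ f ⊛ g ⊕ f' ⊛ g
  ⊛-distribʳ []      f'       g = ≃-refl
  ⊛-distribʳ (a ∷ f) []       g = ≃-sym (⊕-identityʳ _ ≃-refl)
  ⊛-distribʳ (a ∷ f) (b ∷ f') g = begin
    (a + b) · g ⊕ (0# ∷ (f ⊕ f') ⊛ g)
      ≈⟨ ⊕-cong (·-distribʳ a b g) (∷-cong R.refl (⊛-distribʳ f f' g)) ⟩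
    (a · g ⊕ b · g) ⊕ (0# ∷ (f ⊛ g ⊕ f' ⊛ g))
      ≈⟨ ⊕-congˡ (0∷-⊕ (f ⊛ g) (f' ⊛ g)) ⟩
    (a · g ⊕ b · g) ⊕ ((0# ∷ f ⊛ g) ⊕ (0# ∷ f' ⊛ g))
      ≈⟨ ⊕-interchange (a · g) (b · g) _ _ ⟩
    (a · g ⊕ (0# ∷ f ⊛ g)) ⊕ (b · g ⊕ (0# ∷ f' ⊛ g))
      ∎
    where open ≃-Reasoning

  ·-⊛ : ∀ c f g → (c · f) ⊛ g ≃ c · (f ⊛ g)
  ·-⊛ c []      g = ≃-refl
  ·-⊛ c (a ∷ f) g = begin
    (c * a) · g ⊕ (0# ∷ (c · f) ⊛ g)    ≈⟨ ⊕-cong (≃-sym (·-assoc c a g)) (∷-cong R.refl (·-⊛ c f g)) ⟩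
    c · (a · g) ⊕ (0# ∷ c · (f ⊛ g))    ≈⟨ ⊕-congˡ (≃-sym (·-0∷ c (f ⊛ g))) ⟩
    c · (a · g) ⊕ c · (0# ∷ f ⊛ g)      ≈⟨ ·-distribˡ c (a · g) _ ⟨
    c · (a · g ⊕ (0# ∷ f ⊛ g))          ∎
    where open ≃-Reasoning

  ⊛-∷ʳ : ∀ f b g → f ⊛ (b ∷ g) ≃ b · f ⊕ (0# ∷ f ⊛ g)
  ⊛-∷ʳ []      b g = ≃-sym (∷-≃[] R.refl ≃-refl)
  ⊛-∷ʳ (a ∷ f) b g = ∷-cong (R.+-congʳ (R.*-comm a b)) (begin
    a · g ⊕ f ⊛ (b ∷ g)                  ≈⟨ ⊕-congˡ (⊛-∷ʳ f b g) ⟩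
    a · g ⊕ (b · f ⊕ (0# ∷ f ⊛ g))       ≈⟨ ⊕-assoc (a · g) (b · f) _ ⟨
    (a · g ⊕ b · f) ⊕ (0# ∷ f ⊛ g)       ≈⟨ ⊕-cong (⊕-comm (a · g) (b · f)) ≃-refl ⟩
    (b · f ⊕ a · g) ⊕ (0# ∷ f ⊛ g)       ≈⟨ ⊕-assoc (b · f) (a · g) _ ⟩
    b · f ⊕ (a · g ⊕ (0# ∷ f ⊛ g))       ∎)
    where open ≃-Reasoning

  ⊛-comm : ∀ f g → f ⊛ g ≃ g ⊛ f
  ⊛-comm []      g = ≃-sym (⊛-zeroʳ g)
  ⊛-comm (a ∷ f) g = ≃-trans (⊕-congˡ (∷-cong R.refl (⊛-comm f g))) (≃-sym (⊛-∷ʳ g a f))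

  ⊛-assoc : ∀ f g h → (f ⊛ g) ⊛ h ≃ f ⊛ (g ⊛ h)
  ⊛-assoc []      g h = ≃-refl
  ⊛-assoc (a ∷ f) g h = begin
    (a · g ⊕ (0# ∷ f ⊛ g)) ⊛ h           ≈⟨ ⊛-distribʳ (a · g) _ h ⟩
    (a · g) ⊛ h ⊕ (0# ∷ f ⊛ g) ⊛ h       ≈⟨ ⊕-cong (·-⊛ a g h) (0∷-⊛ (f ⊛ g) h) ⟩
    a · (g ⊛ h) ⊕ (0# ∷ (f ⊛ g) ⊛ h)     ≈⟨ ⊕-congˡ (∷-cong R.refl (⊛-assoc f g h)) ⟩
    a · (g ⊛ h) ⊕ (0# ∷ f ⊛ (g ⊛ h))     ∎
    where open ≃-Reasoning

  ⊛-distribˡ : ∀ f g g' → f ⊛ (g ⊕ g') ≃ f ⊛ g ⊕ f ⊛ g'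
  ⊛-distribˡ f g g' = begin
    f ⊛ (g ⊕ g')       ≈⟨ ⊛-comm f (g ⊕ g') ⟩
    (g ⊕ g') ⊛ f       ≈⟨ ⊛-distribʳ g g' f ⟩
    g ⊛ f ⊕ g' ⊛ f     ≈⟨ ⊕-cong (⊛-comm g f) (⊛-comm g' f) ⟩
    f ⊛ g ⊕ f ⊛ g'     ∎
    where open ≃-Reasoning

  ⊛-· : ∀ c f g → f ⊛ (c · g) ≃ c · (f ⊛ g)
  ⊛-· c f g = ≃-trans (⊛-comm f (c · g)) (≃-trans (·-⊛ c g f) (·-cong R.refl (⊛-comm g f)))

  ⊛-identityʳ : ∀ f → f ⊛ [ 1# ] ≃ f
  ⊛-identityʳ f = begin
    f ⊛ [ 1# ]               ≈⟨ ⊛-comm f [ 1# ] ⟩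
    1# · f ⊕ (0# ∷ [])       ≈⟨ ⊕-identityʳ (1# · f) (∷-≃[] R.refl ≃-refl) ⟩
    1# · f                   ≈⟨ ·-identityˡ f ⟩
    f                        ∎
    where open ≃-Reasoning

  ⊕-·-1-inverseʳ : ∀ g → g ⊕ (- 1#) · g ≃ []
  ⊕-·-1-inverseʳ g = coefwise λ i → begin
    coef (g ⊕ (- 1#) · g) i             ≈⟨ coef-⊕ g _ i ⟩
    coef g i + coef ((- 1#) · g) i      ≈⟨ R.+-congˡ (coef-· (- 1#) g i) ⟩
    coef g i + (- 1#) * coef g i        ≈⟨ R.+-congˡ (-1*x≈-x _) ⟩
    coef g i + - coef g i               ≈⟨ R.-‿inverseʳ _ ⟩
    0#                                  ∎
    where open ≈-Reasoning

  ∣-resp-≃ : ∀ {d f f'} → f ≃ f' → d ∣ f → d ∣ f'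
  ∣-resp-≃ f≃f' (g , dg≐f) = g , ≃⇒≐ (≃-trans (≐⇒≃ dg≐f) f≃f')

  ∣-refl : ∀ d → d ∣ d
  ∣-refl d = [ 1# ] , ≃⇒≐ (⊛-identityʳ d)

  ∣-[] : ∀ d → d ∣ []
  ∣-[] d = [] , ≃⇒≐ (⊛-zeroʳ d)

  [1]∣ : ∀ f → [ 1# ] ∣ f
  [1]∣ f = f , ≃⇒≐ (≃-trans (⊕-identityʳ (1# · f) (∷-≃[] R.refl ≃-refl)) (·-identityˡ f))

  ∣-⊕ : ∀ {d f g} → d ∣ f → d ∣ g → d ∣ (f ⊕ g)
  ∣-⊕ {d} (h , dh≐f) (k , dk≐g) =
    h ⊕ k , ≃⇒≐ (≃-trans (⊛-distribˡ d h k) (⊕-cong (≐⇒≃ dh≐f) (≐⇒≃ dk≐g)))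

  ∣-⊛ : ∀ {d f} h → d ∣ f → d ∣ (h ⊛ f)
  ∣-⊛ {d} {f} h (k , dk≐f) = h ⊛ k , ≃⇒≐ (begin
    d ⊛ (h ⊛ k)   ≈⟨ ⊛-assoc d h k ⟨
    (d ⊛ h) ⊛ k   ≈⟨ ⊛-congˡ k (⊛-comm d h) ⟩
    (h ⊛ d) ⊛ k   ≈⟨ ⊛-assoc h d k ⟩
    h ⊛ (d ⊛ k)   ≈⟨ ⊛-congʳ h (≐⇒≃ dk≐f) ⟩
    h ⊛ f         ∎)
    where open ≃-Reasoning

  ∣-· : ∀ {d f} c → d ∣ f → d ∣ (c · f)
  ∣-· {d} c (k , dk≐f) = c · k , ≃⇒≐ (≃-trans (⊛-· c d k) (·-cong R.refl (≐⇒≃ dk≐f)))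

  ·-inverse : ∀ {c} → ¬ (c ≡ 0#) → ∃ λ c⁻¹ → ∀ f → c⁻¹ · (c · f) ≃ f
  ·-inverse {c} c≢0 with c⁻¹ , cc⁻¹≡1 ← inverse c c≢0 = c⁻¹ , λ f → begin
    c⁻¹ · (c · f)   ≈⟨ ·-assoc c⁻¹ c f ⟩
    (c⁻¹ * c) · f   ≈⟨ ·-cong (R.trans (R.*-comm c⁻¹ c) (R.reflexive cc⁻¹≡1)) ≃-refl ⟩
    1# · f          ≈⟨ ·-identityˡ f ⟩
    f               ∎
    where open ≃-Reasoning

  ·-cancel : ∀ {c f g} → ¬ (c ≡ 0#) → c · f ≃ c · g → f ≃ g
  ·-cancel {f = f} {g} c≢0 cf≃cg with c⁻¹ , c⁻¹-inverse ← ·-inverse c≢0 =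
    ≃-trans (≃-sym (c⁻¹-inverse f)) (≃-trans (·-cong R.refl cf≃cg) (c⁻¹-inverse g))

  ∣-·⁻¹ : ∀ {d f c} → ¬ (c ≡ 0#) → d ∣ (c · f) → d ∣ f
  ∣-·⁻¹ {d} {f} c≢0 d∣cf with c⁻¹ , c⁻¹-inverse ← ·-inverse c≢0 =
    ∣-resp-≃ {d} (c⁻¹-inverse f) (∣-· {d} c⁻¹ d∣cf)

  ∣-⊕⁻ˡ : ∀ {d f g} → d ∣ (f ⊕ g) → d ∣ g → d ∣ f
  ∣-⊕⁻ˡ {d} {f} {g} d∣f⊕g d∣g = ∣-resp-≃ {d} (begin
    (f ⊕ g) ⊕ (- 1#) · g    ≈⟨ ⊕-assoc f g _ ⟩
    f ⊕ (g ⊕ (- 1#) · g)    ≈⟨ ⊕-identityʳ f (⊕-·-1-inverseʳ g) ⟩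
    f                       ∎) (∣-⊕ {d} d∣f⊕g (∣-· {d} (- 1#) d∣g))
    where open ≃-Reasoning

  Coprime : Pol → Pol → Set
  Coprime f g = ∀ d → d ∣ f → d ∣ g → d ∣ [ 1# ]

  IsGCD-one⇔Coprime : ∀ {f g} → IsGCD [ 1# ] f g ⇔ Coprime f g
  IsGCD-one⇔Coprime {f} {g} = mk⇔ (λ (_ , _ , greatest) → greatest) (λ coprime → [1]∣ f , [1]∣ g , coprime)

  Coprime-sym : ∀ {f g} → Coprime f g → Coprime g f
  Coprime-sym coprime d d∣g d∣f = coprime d d∣f d∣g

  Coprime-resp-≃ : ∀ {f f' g g'} → f ≃ f' → g ≃ g' → Coprime f g → Coprime f' g'
  Coprime-resp-≃ f≃f' g≃g' coprime d d∣f' d∣g' =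
    coprime d (∣-resp-≃ {d} (≃-sym f≃f') d∣f') (∣-resp-≃ {d} (≃-sym g≃g') d∣g')

  Coprime-·ʳ : ∀ {f g c} → ¬ (c ≡ 0#) → Coprime f g ⇔ Coprime f (c · g)
  Coprime-·ʳ c≢0 = mk⇔ (λ coprime d d∣f d∣cg → coprime d d∣f (∣-·⁻¹ {d} c≢0 d∣cg))
                       (λ coprime d d∣f d∣g → coprime d d∣f (∣-· {d} _ d∣g))

  Coprime-division : ∀ {f q r s} → f ≃ q ⊛ r ⊕ s → Coprime r s ⇔ Coprime r f
  Coprime-division {f} {q} {r} {s} f≃qr+s = mk⇔
    (λ coprime d d∣r d∣f → coprime d d∣r
       (∣-⊕⁻ˡ {d} (∣-resp-≃ {d} (≃-trans f≃qr+s (⊕-comm (q ⊛ r) s)) d∣f) (∣-⊛ {d} q d∣r)))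
    (λ coprime d d∣r d∣s → coprime d d∣r (∣-resp-≃ {d} (≃-sym f≃qr+s) (∣-⊕ {d} (∣-⊛ {d} q d∣r) d∣s)))

  record DegreeBelow (n : ℕ) (f : Pol) : Set where
    constructor vanishing
    field coef-≈0 : ∀ i → n ≤ i → coef f i ≈ 0#
  open DegreeBelow public

  DegreeBelow-length : ∀ f → DegreeBelow (length f) f
  DegreeBelow-length f = vanishing (vanish f)
    where
    vanish : ∀ f i → length f ≤ i → coef f i ≈ 0#
    vanish []      i       _         = R.refl
    vanish (a ∷ f) (suc i) (s≤s n≤i) = vanish f i n≤i

  length≡⇒DegreeBelow : ∀ {n} f → length f ≡ n → DegreeBelow n f
  length≡⇒DegreeBelow f refl = DegreeBelow-length f

  DegreeBelow-mono : ∀ {n n' f} → n ≤ n' → DegreeBelow n f → DegreeBelow n' f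
  DegreeBelow-mono n≤n' below = vanishing λ i n'≤i → coef-≈0 below i (Nat.≤-trans n≤n' n'≤i)

  DegreeBelow-resp-≃ : ∀ {n f g} → f ≃ g → DegreeBelow n f → DegreeBelow n g
  DegreeBelow-resp-≃ f≃g below = vanishing λ i n≤i → R.trans (R.sym (coef-≈ f≃g i)) (coef-≈0 below i n≤i)

  DegreeBelow-zero : ∀ {f} → DegreeBelow 0 f → f ≃ []
  DegreeBelow-zero below = coefwise λ i → coef-≈0 below i z≤n

  DegreeBelow-∷ : ∀ {n a f} → DegreeBelow (suc n) (a ∷ f) → DegreeBelow n f
  DegreeBelow-∷ below = vanishing λ i n≤i → coef-≈0 below (suc i) (s≤s n≤i)

  DegreeBelow-⊕ : ∀ {n f g} → DegreeBelow n f → DegreeBelow n g → DegreeBelow n (f ⊕ g)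
  DegreeBelow-⊕ {f = f} {g} f-below g-below = vanishing λ i n≤i →
    R.trans (coef-⊕ f g i) (R.trans (R.+-cong (coef-≈0 f-below i n≤i) (coef-≈0 g-below i n≤i)) (R.+-identityˡ 0#))

  DegreeBelow-· : ∀ {n f} c → DegreeBelow n f → DegreeBelow n (c · f)
  DegreeBelow-· {f = f} c below = vanishing λ i n≤i →
    R.trans (coef-· c f i) (R.trans (R.*-congˡ (coef-≈0 below i n≤i)) (R.zeroʳ c))

  DegreeBelow-⊛ : ∀ {a b f g} → DegreeBelow a f → DegreeBelow (suc b) g → DegreeBelow (a ℕ.+ b) (f ⊛ g)
  DegreeBelow-⊛ {a} {b} {f} {g} f-below g-below = vanishing (vanish a f f-below)
    where
    vanish : ∀ a f → DegreeBelow a f → ∀ i → a ℕ.+ b ≤ i → coef (f ⊛ g) i ≈ 0#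
    vanish a       []      _       i       _ = R.refl
    vanish zero    (x ∷ f) f-below i       _ = coef-≈ (⊛-zeroˡ g (DegreeBelow-zero f-below)) i
    vanish (suc a) (x ∷ f) f-below (suc i) (s≤s a+b≤i) = begin
      coef (x · g ⊕ (0# ∷ f ⊛ g)) (suc i)       ≈⟨ coef-⊕ (x · g) _ (suc i) ⟩
      coef (x · g) (suc i) + coef (f ⊛ g) i     ≈⟨ R.+-cong (coef-≈0 (DegreeBelow-· x g-below) (suc i) (s≤s b≤i))
                                                            (vanish a f (DegreeBelow-∷ f-below) i a+b≤i) ⟩
      0# + 0#                                   ≈⟨ R.+-identityˡ 0# ⟩
      0#                                        ∎
      where
      open ≈-Reasoning
      b≤i = Nat.≤-trans (Nat.m≤n+m b a) a+b≤i

  1≉0 : ¬ (1# ≈ 0#)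
  1≉0 1≈0 = 0≢1 (≈⇒≡ (R.sym 1≈0))

  coef-⊛-top : ∀ {a b f g} → DegreeBelow (suc a) f → DegreeBelow (suc b) g →
               coef (f ⊛ g) (a ℕ.+ b) ≈ coef f a * coef g b
  coef-⊛-top {a} {b} {f} {g} f-below g-below = top a f f-below
    where
    top : ∀ a f → DegreeBelow (suc a) f → coef (f ⊛ g) (a ℕ.+ b) ≈ coef f a * coef g b
    top a []            _       = R.sym (R.zeroˡ _)
    top zero    (x ∷ f) f-below = begin
      coef (x · g ⊕ (0# ∷ f ⊛ g)) b          ≈⟨ coef-⊕ (x · g) _ b ⟩
      coef (x · g) b + coef (0# ∷ f ⊛ g) b   ≈⟨ R.+-cong (coef-· x g b) (coef-≈ 0∷fg≃0 b) ⟩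
      x * coef g b + 0#                      ≈⟨ R.+-identityʳ _ ⟩
      x * coef g b                           ∎
      where
      open ≈-Reasoning
      0∷fg≃0 = ∷-≃[] R.refl (⊛-zeroˡ g (DegreeBelow-zero (DegreeBelow-∷ f-below)))
    top (suc a) (x ∷ f) f-below = begin
      coef (x · g ⊕ (0# ∷ f ⊛ g)) (suc (a ℕ.+ b))       ≈⟨ coef-⊕ (x · g) _ (suc (a ℕ.+ b)) ⟩
      coef (x · g) (suc (a ℕ.+ b)) + coef (f ⊛ g) (a ℕ.+ b)
        ≈⟨ R.+-cong (coef-≈0 (DegreeBelow-· x g-below) _ (s≤s (Nat.m≤n+m b a))) (top a f (DegreeBelow-∷ f-below)) ⟩
      0# + coef f a * coef g b                          ≈⟨ R.+-identityˡ _ ⟩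
      coef f a * coef g b                               ∎
      where open ≈-Reasoning

  coef≉0⇒< : ∀ {n a f} → ¬ (coef f a ≈ 0#) → DegreeBelow n f → a < n
  coef≉0⇒< {n} {a} a≉0 below = Nat.≰⇒> λ n≤a → a≉0 (coef-≈0 below a n≤a)

  leading-unique : ∀ {a b f} → DegreeBelow (suc a) f → ¬ (coef f a ≈ 0#) →
                   DegreeBelow (suc b) f → ¬ (coef f b ≈ 0#) → a ≡ b
  leading-unique a-below a≉0 b-below b≉0 =
    Nat.≤-antisym (Nat.≤-pred (coef≉0⇒< a≉0 b-below)) (Nat.≤-pred (coef≉0⇒< b≉0 a-below))

  MonicOfDegree : ℕ → Pol → Set
  MonicOfDegree n f = DegreeBelow (suc n) f × coef f n ≈ 1#

  MonicOfDegree-unique : ∀ {a b f} → MonicOfDegree a f → MonicOfDegree b f → a ≡ b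
  MonicOfDegree-unique (a-below , a-lead) (b-below , b-lead) =
    leading-unique a-below (1≉0 ∘ R.trans (R.sym a-lead)) b-below (1≉0 ∘ R.trans (R.sym b-lead))

  MonicOfDegree-⊛ : ∀ {a b f g} → MonicOfDegree a f → MonicOfDegree b g → MonicOfDegree (a ℕ.+ b) (f ⊛ g)
  MonicOfDegree-⊛ {a} {b} (f-below , f-lead) (g-below , g-lead) =
    DegreeBelow-⊛ f-below g-below ,
    R.trans (coef-⊛-top f-below g-below) (R.trans (R.*-cong f-lead g-lead) (R.*-identityˡ 1#))

  MonicOfDegree-⊕ : ∀ {n f g} → MonicOfDegree n f → DegreeBelow n g → MonicOfDegree n (f ⊕ g)
  MonicOfDegree-⊕ {n} {f} {g} (f-below , f-lead) g-below =
    DegreeBelow-⊕ f-below (DegreeBelow-mono (Nat.n≤1+n n) g-below) ,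
    R.trans (coef-⊕ f g n) (R.trans (R.+-cong f-lead (coef-≈0 g-below n Nat.≤-refl)) (R.+-identityʳ 1#))

  MonicOfDegree-resp-≃ : ∀ {n f g} → f ≃ g → MonicOfDegree n f → MonicOfDegree n g
  MonicOfDegree-resp-≃ {n} f≃g (f-below , f-lead) =
    DegreeBelow-resp-≃ f≃g f-below , R.trans (R.sym (coef-≈ f≃g n)) f-lead

  monic : Pol → Pol
  monic v = v ++ [ 1# ]

  length-monic : ∀ v → length (monic v) ≡ suc (length v)
  length-monic []      = refl
  length-monic (a ∷ v) = cong suc (length-monic v)

  monic-MonicOfDegree : ∀ v → MonicOfDegree (length v) (monic v)
  monic-MonicOfDegree v = subst (λ n → DegreeBelow n (monic v)) (length-monic v) (DegreeBelow-length (monic v)) ,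
                          top v
    where
    top : ∀ v → coef (monic v) (length v) ≈ 1#
    top []      = R.refl
    top (a ∷ v) = top v

  ⊛-monic-cancel : ∀ v g → DegreeBelow (length v) (g ⊛ monic v) → g ≃ []
  ⊛-monic-cancel v g product-below = DegreeBelow-zero (lower (length g) (DegreeBelow-length g))
    where
    lower : ∀ n → DegreeBelow n g → DegreeBelow 0 g
    lower zero    g-below = g-below
    lower (suc n) g-below = lower n (vanishing vanish)
      where
      vanish : ∀ i → n ≤ i → coef g i ≈ 0#
      vanish i n≤i with Nat.m≤n⇒m<n∨m≡n n≤i
      ... | inj₁ n<i  = coef-≈0 g-below i n<i
      ... | inj₂ refl = begin
        coef g n                                ≈⟨ R.*-identityʳ _ ⟨
        coef g n * 1#                           ≈⟨ R.*-congˡ (proj₂ (monic-MonicOfDegree v)) ⟨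
        coef g n * coef (monic v) (length v)    ≈⟨ coef-⊛-top g-below (proj₁ (monic-MonicOfDegree v)) ⟨
        coef (g ⊛ monic v) (n ℕ.+ length v)     ≈⟨ coef-≈0 product-below _ (Nat.m≤n+m (length v) n) ⟩
        0#                                      ∎
        where open ≈-Reasoning

  monic-∤-one : ∀ v → 1 ≤ length v → ¬ (monic v ∣ [ 1# ])
  monic-∤-one v 1≤|v| (g , monic-v·g≐1) = 1≉0 (proj₁ (∷-≃[]⁻ 1≃0))
    where
    g·monic-v≃1 : g ⊛ monic v ≃ [ 1# ]
    g·monic-v≃1 = ≃-trans (⊛-comm g (monic v)) (≐⇒≃ monic-v·g≐1)
    g≃0 : g ≃ []
    g≃0 = ⊛-monic-cancel v g
            (DegreeBelow-resp-≃ (≃-sym g·monic-v≃1) (DegreeBelow-mono 1≤|v| (DegreeBelow-length [ 1# ])))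
    1≃0 : [ 1# ] ≃ []
    1≃0 = ≃-trans (≃-sym g·monic-v≃1) (⊛-zeroˡ (monic v) g≃0)

  ¬Coprime-[]-[] : ∀ {f g} → f ≃ [] → g ≃ [] → ¬ Coprime f g
  ¬Coprime-[]-[] {f} {g} f≃0 g≃0 coprime = monic-∤-one [ 0# ] (s≤s z≤n)
    (coprime X (∣-resp-≃ {X} (≃-sym f≃0) (∣-[] X)) (∣-resp-≃ {X} (≃-sym g≃0) (∣-[] X)))
    where X = monic [ 0# ]

  Coprime-[]-monic : ∀ {f} v → f ≃ [] → Coprime f (monic v) → v ≡ []
  Coprime-[]-monic []      _   _       = refl
  Coprime-[]-monic (a ∷ v) f≃0 coprime = ⊥-elim (monic-∤-one (a ∷ v) (s≤s z≤n)
    (coprime g (∣-resp-≃ {g} (≃-sym f≃0) (∣-[] g)) (∣-refl g)))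
    where g = monic (a ∷ v)

  toVec : (n : ℕ) → Pol → Vec Carrier n
  toVec n f = Vec.tabulate (coef f ∘ Fin.toℕ)

  resize : ℕ → Pol → Pol
  resize n f = toList (toVec n f)

  length-resize : ∀ n f → length (resize n f) ≡ n
  length-resize n f = Vec.length-toList (toVec n f)

  toVec-cong : ∀ n {f g} → f ≃ g → toVec n f ≡ toVec n g
  toVec-cong n f≃g = Vec.tabulate-cong (≈⇒≡ ∘ coef-≈ f≃g ∘ Fin.toℕ)

  toVec-toList : ∀ {n} (v : Vec Carrier n) → toVec n (toList v) ≡ v
  toVec-toList []      = refl
  toVec-toList (a ∷ v) = cong (a ∷_) (toVec-toList v)

  resize-cong : ∀ n {f g} → f ≃ g → resize n f ≡ resize n g
  resize-cong n f≃g = cong toList (toVec-cong n f≃g)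

  resize-length : ∀ {n} f → length f ≡ n → resize n f ≡ f
  resize-length []      refl = refl
  resize-length (a ∷ f) refl = cong (a ∷_) (resize-length f refl)

  resize-monic : ∀ {n} v → length v ≡ n → resize n (monic v) ≡ v
  resize-monic []      refl = refl
  resize-monic (a ∷ v) refl = cong (a ∷_) (resize-monic v refl)

  resize-≃ : ∀ n {f} → DegreeBelow n f → resize n f ≃ f
  resize-≃ zero    f-below = ≃-sym (DegreeBelow-zero f-below)
  resize-≃ (suc n) {[]}    _       = ∷-≃[] R.refl (resize-≃ n (vanishing λ _ _ → R.refl))
  resize-≃ (suc n) {a ∷ f} f-below = ∷-cong R.refl (resize-≃ n (DegreeBelow-∷ f-below))

  monic-resize : ∀ n {f} → MonicOfDegree n f → monic (resize n f) ≃ f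
  monic-resize zero    (f-below , f-lead) =
    coefwise λ { zero → R.sym f-lead ; (suc i) → R.sym (coef-≈0 f-below (suc i) (s≤s z≤n)) }
  monic-resize (suc n) {[]}    (_ , 0≈1) = ⊥-elim (1≉0 (R.sym 0≈1))
  monic-resize (suc n) {a ∷ f} (f-below , f-lead) = ∷-cong R.refl (monic-resize n (DegreeBelow-∷ f-below , f-lead))

  monic-injective : ∀ {v v'} → monic v ≃ monic v' → v ≡ v'
  monic-injective {v} {v'} monic-v≃monic-v' = proj₁ (List.∷ʳ-injective v v' (≃⇒≡ same-length monic-v≃monic-v'))
    where
    same-length : length (monic v) ≡ length (monic v')
    same-length = trans (length-monic v) (trans (cong suc (MonicOfDegree-unique (monic-MonicOfDegree v)
                    (MonicOfDegree-resp-≃ (≃-sym monic-v≃monic-v') (monic-MonicOfDegree v'))))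
                    (sym (length-monic v')))

  record Division (f v : Pol) (j : ℕ) : Set where
    field
      quotient remainder : Pol
      length-quotient    : length quotient ≡ j
      length-remainder   : length remainder ≡ length v
      division           : f ≃ quotient ⊛ monic v ⊕ remainder

  divide : ∀ v j f → length f ≡ j ℕ.+ length v → Division f v j
  divide v zero    f       len = record
    { quotient = [] ; remainder = f ; length-quotient = refl ; length-remainder = len ; division = ≃-refl }
  divide v (suc j) (a ∷ f) len = record
    { quotient         = l ∷ quotient
    ; remainder        = resize k u
    ; length-quotient  = cong suc length-quotient
    ; length-remainder = length-resize k u
    ; division         = a∷f≃
    }
    where
    open Division (divide v j f (Nat.suc-injective len))
    k = length v
    d = monic v
    t = a ∷ remainder
    l = coef t k
    u = t ⊕ (- l) · d

    u-below : DegreeBelow k u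
    u-below = vanishing vanish
      where
      vanish : ∀ i → k ≤ i → coef u i ≈ 0#
      vanish i k≤i with Nat.m≤n⇒m<n∨m≡n k≤i
      ... | inj₁ k<i = coef-≈0 (DegreeBelow-⊕ t-below (DegreeBelow-· (- l) (proj₁ (monic-MonicOfDegree v)))) i k<i
        where
        t-below : DegreeBelow (suc k) t
        t-below = subst (λ n → DegreeBelow (suc n) t) length-remainder (DegreeBelow-length t)
      ... | inj₂ refl = begin
        coef u k                           ≈⟨ coef-⊕ t ((- l) · d) k ⟩
        l + coef ((- l) · d) k             ≈⟨ R.+-congˡ (coef-· (- l) d k) ⟩
        l + (- l) * coef d k               ≈⟨ R.+-congˡ (R.*-congˡ (proj₂ (monic-MonicOfDegree v))) ⟩
        l + (- l) * 1#                     ≈⟨ R.+-congˡ (R.*-identityʳ (- l)) ⟩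
        l + - l                            ≈⟨ R.-‿inverseʳ l ⟩
        0#                                 ∎
        where open ≈-Reasoning

    a∷f≃ : a ∷ f ≃ (l ∷ quotient) ⊛ d ⊕ resize k u
    a∷f≃ = begin
      a ∷ f                                                  ≈⟨ ∷-cong (R.sym (R.+-identityˡ a)) division ⟩
      (0# ∷ quotient ⊛ d) ⊕ t                                ≈⟨ ⊕-identityˡ _ ld-ld≃0 ⟨
      (l · d ⊕ (- l) · d) ⊕ ((0# ∷ quotient ⊛ d) ⊕ t)        ≈⟨ ⊕-interchange (l · d) _ _ t ⟩
      (l · d ⊕ (0# ∷ quotient ⊛ d)) ⊕ ((- l) · d ⊕ t)
        ≈⟨ ⊕-congˡ {l · d ⊕ (0# ∷ quotient ⊛ d)} (⊕-comm ((- l) · d) t) ⟩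
      (l ∷ quotient) ⊛ d ⊕ u
        ≈⟨ ⊕-congˡ {(l ∷ quotient) ⊛ d} (resize-≃ k u-below) ⟨
      (l ∷ quotient) ⊛ d ⊕ resize k u                        ∎
      where
      open ≃-Reasoning
      ld-ld≃0 : l · d ⊕ (- l) · d ≃ []
      ld-ld≃0 = ≃-trans (≃-sym (·-distribʳ l (- l) d)) (≃-trans (·-cong (R.-‿inverseʳ l) ≃-refl) (·-zeroˡ d))

  ⊕-cancelˡ : ∀ f {g h} → f ⊕ g ≃ f ⊕ h → g ≃ h
  ⊕-cancelˡ f {g} {h} eq = coefwise λ i →
    +-cancelˡ (coef f i) _ _ (R.trans (R.sym (coef-⊕ f g i)) (R.trans (coef-≈ eq i) (coef-⊕ f h i)))

  ⊕-·-1≃[]⇒≃ : ∀ {f g} → f ⊕ (- 1#) · g ≃ [] → f ≃ g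
  ⊕-·-1≃[]⇒≃ {f} {g} f-g≃0 = coefwise λ i → x+-y≈0⇒x≈y _ _ (begin
    coef f i + - coef g i               ≈⟨ R.+-congˡ (-1*x≈-x _) ⟨
    coef f i + (- 1#) * coef g i        ≈⟨ R.+-congˡ (coef-· (- 1#) g i) ⟨
    coef f i + coef ((- 1#) · g) i      ≈⟨ coef-⊕ f _ i ⟨
    coef (f ⊕ (- 1#) · g) i             ≈⟨ coef-≈ f-g≃0 i ⟩
    0#                                  ∎)
    where open ≈-Reasoning

  division-unique : ∀ v {q q' s s'} → DegreeBelow (length v) s → DegreeBelow (length v) s' →
                    q ⊛ monic v ⊕ s ≃ q' ⊛ monic v ⊕ s' → q ≃ q' × s ≃ s'
  division-unique v {q} {q'} {s} {s'} s-below s'-below eq = q≃q' , s≃s'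
    where
    d = monic v

    high-coefs-agree : ∀ i → length v ≤ i → coef (q ⊛ d) i ≈ coef (q' ⊛ d) i
    high-coefs-agree i k≤i = begin
      coef (q ⊛ d) i                  ≈⟨ R.+-identityʳ _ ⟨
      coef (q ⊛ d) i + 0#             ≈⟨ R.+-congˡ (coef-≈0 s-below i k≤i) ⟨
      coef (q ⊛ d) i + coef s i       ≈⟨ coef-⊕ (q ⊛ d) s i ⟨
      coef (q ⊛ d ⊕ s) i              ≈⟨ coef-≈ eq i ⟩
      coef (q' ⊛ d ⊕ s') i            ≈⟨ coef-⊕ (q' ⊛ d) s' i ⟩
      coef (q' ⊛ d) i + coef s' i     ≈⟨ R.+-congˡ (coef-≈0 s'-below i k≤i) ⟩
      coef (q' ⊛ d) i + 0#            ≈⟨ R.+-identityʳ _ ⟩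
      coef (q' ⊛ d) i                 ∎
      where open ≈-Reasoning

    difference-below : DegreeBelow (length v) ((q ⊕ (- 1#) · q') ⊛ d)
    difference-below = vanishing λ i k≤i → begin
      coef ((q ⊕ (- 1#) · q') ⊛ d) i             ≈⟨ coef-≈ (⊛-distribʳ q _ d) i ⟩
      coef (q ⊛ d ⊕ ((- 1#) · q') ⊛ d) i         ≈⟨ coef-≈ (⊕-congˡ {q ⊛ d} (·-⊛ (- 1#) q' d)) i ⟩
      coef (q ⊛ d ⊕ (- 1#) · (q' ⊛ d)) i         ≈⟨ coef-⊕ (q ⊛ d) _ i ⟩
      coef (q ⊛ d) i + coef ((- 1#) · (q' ⊛ d)) i  ≈⟨ R.+-congʳ (high-coefs-agree i k≤i) ⟩
      coef (q' ⊛ d) i + coef ((- 1#) · (q' ⊛ d)) i ≈⟨ coef-⊕ (q' ⊛ d) _ i ⟨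
      coef (q' ⊛ d ⊕ (- 1#) · (q' ⊛ d)) i        ≈⟨ coef-≈ (⊕-·-1-inverseʳ (q' ⊛ d)) i ⟩
      0#                                         ∎
      where open ≈-Reasoning

    q≃q' : q ≃ q'
    q≃q' = ⊕-·-1≃[]⇒≃ (⊛-monic-cancel v _ difference-below)

    s≃s' : s ≃ s'
    s≃s' = ⊕-cancelˡ (q ⊛ d) (≃-trans eq (⊕-cong (⊛-congˡ d (≃-sym q≃q')) ≃-refl))

  ·-monic-DegreeBelow : ∀ c v → DegreeBelow (suc (length v)) (c · monic v)
  ·-monic-DegreeBelow c v = DegreeBelow-· c (proj₁ (monic-MonicOfDegree v))

  coef-·-monic-top : ∀ c v → coef (c · monic v) (length v) ≈ c
  coef-·-monic-top c v = R.trans (coef-· c (monic v) (length v))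
                           (R.trans (R.*-congˡ (proj₂ (monic-MonicOfDegree v))) (R.*-identityʳ c))

  ·-monic-injective : ∀ {c c' v v'} → ¬ (c ≡ 0#) → ¬ (c' ≡ 0#) →
                      c · monic v ≃ c' · monic v' → c ≡ c' × v ≡ v'
  ·-monic-injective {c} {c'} {v} {v'} c≢0 c'≢0 eq = ≈⇒≡ c≈c' , monic-injective (·-cancel c≢0 monic-v≃monic-v')
    where
    same-length : length v ≡ length v'
    same-length = leading-unique (·-monic-DegreeBelow c v) (c≢0 ∘ ≈⇒≡ ∘ R.trans (R.sym (coef-·-monic-top c v)))
                    (DegreeBelow-resp-≃ (≃-sym eq) (·-monic-DegreeBelow c' v'))
                    (c'≢0 ∘ ≈⇒≡ ∘ R.trans (R.sym (coef-·-monic-top c' v'))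
                          ∘ R.trans (R.sym (coef-≈ eq (length v'))))
    c≈c' : c ≈ c'
    c≈c' = R.trans (R.sym (coef-·-monic-top c v)) (R.trans (coef-≈ eq (length v))
             (subst (λ n → coef (c' · monic v') n ≈ c') (sym same-length) (coef-·-monic-top c' v')))
    monic-v≃monic-v' : c · monic v ≃ c · monic v'
    monic-v≃monic-v' = ≃-trans eq (·-cong (R.sym c≈c') ≃-refl)

  division-quotient-monic : ∀ v {n f q s} → MonicOfDegree (n ℕ.+ length v) f → DegreeBelow (suc n) q →
                            DegreeBelow (length v) s → f ≃ q ⊛ monic v ⊕ s → MonicOfDegree n q
  division-quotient-monic v {n} {f} {q} {s} (_ , f-lead) q-below s-below f≃qv+s = q-below , (begin
    coef q n                                     ≈⟨ R.*-identityʳ _ ⟨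
    coef q n * 1#                                ≈⟨ R.*-congˡ (proj₂ (monic-MonicOfDegree v)) ⟨
    coef q n * coef (monic v) (length v)         ≈⟨ coef-⊛-top q-below (proj₁ (monic-MonicOfDegree v)) ⟨
    coef (q ⊛ monic v) (n ℕ.+ length v)          ≈⟨ R.+-identityʳ _ ⟨
    coef (q ⊛ monic v) (n ℕ.+ length v) + 0#     ≈⟨ R.+-congˡ (coef-≈0 s-below _ (Nat.m≤n+m (length v) n)) ⟨
    coef (q ⊛ monic v) (n ℕ.+ length v) + coef s (n ℕ.+ length v)  ≈⟨ coef-⊕ (q ⊛ monic v) s _ ⟨
    coef (q ⊛ monic v ⊕ s) (n ℕ.+ length v)      ≈⟨ coef-≈ f≃qv+s _ ⟨
    coef f (n ℕ.+ length v)                      ≈⟨ f-lead ⟩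
    1#                                           ∎)
    where open ≈-Reasoning

  module _ (_≟_ : DecidableEquality Carrier) where

    zero-or-scaled-monic : ∀ f → f ≃ [] ⊎ ∃₂ λ c v → ¬ (c ≡ 0#) × f ≃ c · monic v
    zero-or-scaled-monic []      = inj₁ ≃-refl
    zero-or-scaled-monic (a ∷ f) with zero-or-scaled-monic f
    ... | inj₂ (c , v , c≢0 , f≃cv) with c⁻¹ , cc⁻¹≡1 ← inverse c c≢0 =
      inj₂ (c , c⁻¹ * a ∷ v , c≢0 , ∷-cong a≈c[c⁻¹a] f≃cv)
      where
      a≈c[c⁻¹a] : a ≈ c * (c⁻¹ * a)
      a≈c[c⁻¹a] = R.sym (R.trans (R.sym (R.*-assoc c c⁻¹ a))
                    (R.trans (R.*-congʳ (R.reflexive cc⁻¹≡1)) (R.*-identityˡ a)))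
    ... | inj₁ f≃0 with a ≟ 0#
    ...   | yes a≡0 = inj₁ (∷-≃[] (R.reflexive a≡0) f≃0)
    ...   | no  a≢0 = inj₂ (a , [] , a≢0 , ∷-cong (R.sym (R.*-identityʳ a)) f≃0)

-- ℕ's _+_ and _*_ are opened only here, so that inside Polynomials they denote the field operations.
open import Data.Nat using (_+_; _*_)

open Equivalence using (to; from)

module _ {A : Set} where

  HasSize-⇔ : {P Q : A → Set} {n : ℕ} → (∀ a → P a ⇔ Q a) → HasSize P n → HasSize Q n
  HasSize-⇔ P⇔Q (L , uniq , len , ∈⇔P) = L , uniq , len , λ a → ⇔.trans (∈⇔P a) (P⇔Q a)

  HasSize-size : {P : A → Set} {n m : ℕ} → n ≡ m → HasSize P n → HasSize P m
  HasSize-size refl size = size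

  HasSize-singleton : (x : A) → HasSize (_≡ x) 1
  HasSize-singleton x = [ x ] , [] ∷ [] , refl ,
    λ a → mk⇔ (λ { (here a≡x) → a≡x ; (there ()) }) here

  HasSize-⊎ : {P Q : A → Set} {n m : ℕ} → (∀ {a} → P a → ¬ Q a) →
              HasSize P n → HasSize Q m → HasSize (λ a → P a ⊎ Q a) (n + m)
  HasSize-⊎ {P} {Q} disjoint (L , uniqL , refl , ∈L⇔P) (K , uniqK , refl , ∈K⇔Q) =
    L ++ K ,
    Unique.++⁺ uniqL uniqK (λ (∈L , ∈K) → disjoint (to (∈L⇔P _) ∈L) (to (∈K⇔Q _) ∈K)) ,
    length-++ L ,
    λ a → mk⇔ (from-++ ∘ ∈-++⁻ L) to-++
    where
    from-++ : ∀ {a} → a ∈ L ⊎ a ∈ K → P a ⊎ Q a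
    from-++ (inj₁ ∈L) = inj₁ (to (∈L⇔P _) ∈L)
    from-++ (inj₂ ∈K) = inj₂ (to (∈K⇔Q _) ∈K)
    to-++ : ∀ {a} → P a ⊎ Q a → a ∈ L ++ K
    to-++ (inj₁ p) = ∈-++⁺ˡ (from (∈L⇔P _) p)
    to-++ (inj₂ q) = ∈-++⁺ʳ L (from (∈K⇔Q _) q)

module _ {A B : Set} (φ : A → B) where

  Unique-map : (L : List A) → (∀ {x y} → x ∈ L → y ∈ L → φ x ≡ φ y → x ≡ y) →
               Unique L → Unique (map φ L)
  Unique-map [] injective [] = []
  Unique-map (x ∷ L) injective (x∉L ∷ uniq) =
    distinct L x∉L (λ y∈L → injective (here refl) (there y∈L)) ∷
    Unique-map L (λ x∈L y∈L → injective (there x∈L) (there y∈L)) uniq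
    where
    distinct : ∀ K → All (x ≢_) K → (∀ {y} → y ∈ K → φ x ≡ φ y → x ≡ y) → All (φ x ≢_) (map φ K)
    distinct [] [] _ = []
    distinct (y ∷ K) (x≢y ∷ x∉K) inj =
      (x≢y ∘ inj (here refl)) ∷ distinct K x∉K (inj ∘ there)

  HasSize-image : {P : A → Set} {Q : B → Set} {n : ℕ} →
                  (∀ {x y} → P x → P y → φ x ≡ φ y → x ≡ y) →
                  (∀ {x} → P x → Q (φ x)) →
                  (∀ {b} → Q b → ∃ λ a → P a × φ a ≡ b) →
                  HasSize P n → HasSize Q n
  HasSize-image {P} {Q} injective maps-to onto (L , uniq , refl , ∈⇔P) =
    map φ L ,
    Unique-map L (λ x∈L y∈L → injective (to (∈⇔P _) x∈L) (to (∈⇔P _) y∈L)) uniq ,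
    length-map φ L ,
    λ b → mk⇔ (from-image ∘ ∈-map⁻ φ) (to-image ∘ onto)
    where
    from-image : ∀ {b} → ∃ (λ a → a ∈ L × b ≡ φ a) → Q b
    from-image (a , a∈L , refl) = maps-to (to (∈⇔P a) a∈L)
    to-image : ∀ {b} → ∃ (λ a → P a × φ a ≡ b) → b ∈ map φ L
    to-image (a , p , refl) = ∈-map⁺ φ (from (∈⇔P a) p)

module _ {A B : Set} where

  HasSize-Σ : {Q : A → B → Set} (n : A → ℕ) (L : List A) → Unique L →
              (∀ a → a ∈ L → HasSize (Q a) (n a)) →
              HasSize {A × B} (λ (a , b) → a ∈ L × Q a b) (sum (map n L))
  HasSize-Σ n [] [] _ = [] , [] , refl , λ _ → mk⇔ (λ ()) (λ ())
  HasSize-Σ {Q} n (x ∷ L) (x∉L ∷ uniq) sizes =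
    HasSize-⇔ split
      (HasSize-⊎ (λ (a≡x , _) (a∈L , _) → All¬⇒¬Any x∉L (subst (_∈ L) a≡x a∈L))
        (HasSize-image (x ,_) (λ _ _ → cong proj₂) (λ q → refl , q)
           (λ { {a , b} (refl , q) → b , q , refl })
           (sizes x (here refl)))
        (HasSize-Σ n L uniq (λ a a∈L → sizes a (there a∈L))))
    where
    split : ∀ ab → ((proj₁ ab ≡ x × Q x (proj₂ ab)) ⊎ (proj₁ ab ∈ L × Q (proj₁ ab) (proj₂ ab)))
                 ⇔ (proj₁ ab ∈ x ∷ L × Q (proj₁ ab) (proj₂ ab))
    split (a , b) = mk⇔ (λ { (inj₁ (refl , q)) → here refl , q ; (inj₂ (a∈L , q)) → there a∈L , q })
                        (λ { (here refl , q) → inj₁ (refl , q) ; (there a∈L , q) → inj₂ (a∈L , q) })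

  sum-map-const : (m : ℕ) (L : List A) → sum (map (const m) L) ≡ length L * m
  sum-map-const m [] = refl
  sum-map-const m (_ ∷ L) = cong (m +_) (sum-map-const m L)

  HasSize-× : {P : A → Set} {Q : B → Set} {n m : ℕ} →
              HasSize P n → HasSize Q m → HasSize {A × B} (λ (a , b) → P a × Q b) (n * m)
  HasSize-× {P} {Q} {m = m} (L , uniq , refl , ∈⇔P) sizeQ =
    HasSize-size (sum-map-const m L)
      (HasSize-⇔ (λ (a , b) → mk⇔ (λ (a∈L , q) → to (∈⇔P a) a∈L , q) (λ (p , q) → from (∈⇔P a) p , q))
        (HasSize-Σ (const m) L uniq (λ _ _ → sizeQ)))

∑< : ℕ → (ℕ → ℕ) → ℕ
∑< t n = sum (map n (downFrom t))

HasSize-Σ< : {B : Set} {Q : ℕ → B → Set} (n : ℕ → ℕ) (t : ℕ) →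
             (∀ k → k < t → HasSize (Q k) (n k)) →
             HasSize {ℕ × B} (λ (k , b) → k < t × Q k b) (∑< t n)
HasSize-Σ< n t sizes =
  HasSize-⇔ (λ (k , b) → mk⇔ (λ (k∈ , q) → ∈-downFrom⁻ k∈ , q) (λ (k<t , q) → ∈-downFrom⁺ k<t , q))
    (HasSize-Σ n (downFrom t) (Unique.downFrom⁺ t) (λ k k∈ → sizes k (∈-downFrom⁻ k∈)))

module FiniteType {C : Set} (q : ℕ) (C↔Fin : Fin q ↔ C) where
  open Inverse C↔Fin renaming (to to enum; from to index)

  enum-injective : ∀ {i j} → enum i ≡ enum j → i ≡ j
  enum-injective {i} {j} eq = trans (sym (strictlyInverseʳ i)) (trans (cong index eq) (strictlyInverseʳ j))

  HasSize-all : HasSize {C} (const ⊤) q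
  HasSize-all = tabulate enum , Unique.tabulate⁺ enum-injective , length-tabulate enum ,
    λ c → mk⇔ (const tt) (λ _ → subst (_∈ tabulate enum) (strictlyInverseˡ c) (∈-tabulate⁺ (index c)))

  _≟_ : DecidableEquality C
  a ≟ b with index a Fin.≟ index b
  ... | yes eq = yes (trans (sym (strictlyInverseˡ a)) (trans (cong enum eq) (strictlyInverseˡ b)))
  ... | no neq = no (neq ∘ cong index)

  HasSize-lists : ∀ k → HasSize {List C} (λ l → length l ≡ k) (q ^ k)
  HasSize-lists zero = HasSize-⇔ (λ { [] → mk⇔ (const refl) (const refl) ; (_ ∷ _) → mk⇔ (λ ()) (λ ()) })
                                 (HasSize-singleton [])
  HasSize-lists (suc k) =
    HasSize-image (λ (a , l) → a ∷ l) (λ { _ _ refl → refl }) (λ (_ , len) → cong suc len)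
      (λ { {[]} () ; {a ∷ l} len → (a , l) , (tt , Nat.suc-injective len) , refl })
      (HasSize-× HasSize-all (HasSize-lists k))

module FiniteTypeWithout {C : Set} (q : ℕ) (C↔Fin : Fin (suc q) ↔ C) (z : C) where
  open Inverse C↔Fin renaming (to to enum; from to index)
  open FiniteType (suc q) C↔Fin using (enum-injective)

  HasSize-≢ : HasSize (_≢ z) q
  HasSize-≢ = tabulate avoid ,
    Unique.tabulate⁺ (Fin.punchIn-injective (index z) _ _ ∘ enum-injective) ,
    length-tabulate avoid ,
    λ c → mk⇔ avoid-≢ (λ c≢z → subst (_∈ tabulate avoid) (hit c≢z) (∈-tabulate⁺ _))
    where
    avoid : Fin q → C
    avoid = enum ∘ punchIn (index z)
    avoid-≢ : ∀ {c} → c ∈ tabulate avoid → c ≢ z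
    avoid-≢ c∈ with i , refl ← ∈-tabulate⁻ c∈ =
      λ eq → Fin.punchInᵢ≢i (index z) i (trans (sym (strictlyInverseʳ _)) (cong index eq))
    index-z≢ : ∀ {c} → c ≢ z → index z ≢ index c
    index-z≢ {c} c≢z eq = c≢z (trans (sym (strictlyInverseˡ c)) (trans (cong enum (sym eq)) (strictlyInverseˡ z)))
    hit : ∀ {c} (c≢z : c ≢ z) → avoid (punchOut (index-z≢ c≢z)) ≡ c
    hit {c} c≢z = trans (cong enum (Fin.punchIn-punchOut (index-z≢ c≢z))) (strictlyInverseˡ c)

module CoprimePairs (F : Field) (q-1 : ℕ) (Fin↔F : Fin (suc q-1) ↔ Field.Carrier F) where
  open Field F using (Carrier; 0#; 1#; ≈⇒≡)
  open Poly F
  open Polynomials F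
  open FiniteType (suc q-1) Fin↔F using (HasSize-lists; _≟_)
  open FiniteTypeWithout q-1 Fin↔F 0# using (HasSize-≢)

  q : ℕ
  q = suc q-1

  coprimeCount : ℕ → ℕ
  coprimeCount zero    = 1
  coprimeCount (suc k) = q-1 * q ^ suc (k + k)

  ∑<-weighted-coprimeCount : ∀ t n → t < n → ∑< (suc t) (λ k → q ^ (n ∸ k) * coprimeCount k) ≡ q ^ (t + n)
  ∑<-weighted-coprimeCount zero    n _   = trans (Nat.+-identityʳ _) (Nat.*-identityʳ (q ^ n))
  ∑<-weighted-coprimeCount (suc t) n 1+t<n = begin
    q ^ (n ∸ suc t) * (q-1 * q ^ suc (t + t)) + ∑< (suc t) (λ k → q ^ (n ∸ k) * coprimeCount k)
      ≡⟨ cong₂ _+_ new-term (∑<-weighted-coprimeCount t n (Nat.<-trans (Nat.n<1+n t) 1+t<n)) ⟩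
    q-1 * q ^ (t + n) + q ^ (t + n)
      ≡⟨ Nat.+-comm (q-1 * q ^ (t + n)) _ ⟩
    q ^ (suc t + n)
      ∎
    where
    open ≡-Reasoning
    open CommutativeSemigroupProperties Nat.*-commutativeSemigroup using (x∙yz≈y∙xz)
    exponent : (n ∸ suc t) + suc (t + t) ≡ t + n
    exponent = begin
      (n ∸ suc t) + (suc t + t)   ≡⟨ Nat.+-assoc (n ∸ suc t) (suc t) t ⟨
      (n ∸ suc t) + suc t + t     ≡⟨ cong (_+ t) (Nat.m∸n+n≡m (Nat.<⇒≤ 1+t<n)) ⟩
      n + t                       ≡⟨ Nat.+-comm n t ⟩
      t + n                       ∎
    new-term : q ^ (n ∸ suc t) * (q-1 * q ^ suc (t + t)) ≡ q-1 * q ^ (t + n)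
    new-term = begin
      q ^ (n ∸ suc t) * (q-1 * q ^ suc (t + t))   ≡⟨ x∙yz≈y∙xz (q ^ (n ∸ suc t)) q-1 _ ⟩
      q-1 * (q ^ (n ∸ suc t) * q ^ suc (t + t))   ≡⟨ cong (q-1 *_) (Nat.^-distribˡ-+-* q (n ∸ suc t) _) ⟨
      q-1 * q ^ ((n ∸ suc t) + suc (t + t))       ≡⟨ cong (λ e → q-1 * q ^ e) exponent ⟩
      q-1 * q ^ (t + n)                           ∎

  MonicCoprime : ℕ → Pol × Pol → Set
  MonicCoprime k (v , r) = length v ≡ k × length r ≡ k × Coprime (monic v) r

  -- (c , k , w , v , s) stands for the pair (monic w ⊛ monic v ⊕ s , c · monic v):
  -- one step of the Euclidean algorithm, read backwards.
  EuclidData : Set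
  EuclidData = Carrier × ℕ × Pol × Pol × Pol

  EuclidStep : ℕ → EuclidData → Set
  EuclidStep m (c , k , w , v , s) = c ≢ 0# × k < m × length w ≡ m ∸ k × MonicCoprime k (v , s)

  dividend divisor : EuclidData → Pol
  dividend (c , k , w , v , s) = monic w ⊛ monic v ⊕ s
  divisor  (c , k , w , v , s) = c · monic v

  euclid : ℕ → EuclidData → Pol × Pol
  euclid m x = resize m (dividend x) , resize m (divisor x)

  dividend-monic : ∀ {m} x → EuclidStep m x → MonicOfDegree m (dividend x)
  dividend-monic {m} (c , k , w , v , s) (_ , k<m , |w| , refl , |s| , _) =
    subst (λ n → MonicOfDegree n (dividend (c , k , w , v , s))) degree
      (MonicOfDegree-⊕ (MonicOfDegree-⊛ (monic-MonicOfDegree w) (monic-MonicOfDegree v))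
        (DegreeBelow-mono (subst (_≤ length w + length v) (sym |s|) (Nat.m≤n+m _ _)) (DegreeBelow-length s)))
    where
    degree : length w + length v ≡ m
    degree = trans (cong (_+ length v) |w|) (Nat.m∸n+n≡m (Nat.<⇒≤ k<m))

  divisor-below : ∀ {m} x → EuclidStep m x → DegreeBelow m (divisor x)
  divisor-below (c , k , w , v , s) (_ , k<m , _ , refl , _) = DegreeBelow-mono k<m (·-monic-DegreeBelow c v)

  dividend-divisor-coprime : ∀ {m} x → EuclidStep m x → Coprime (dividend x) (divisor x)
  dividend-divisor-coprime (c , k , w , v , s) (c≢0 , _ , _ , _ , _ , coprime) =
    to (Coprime-·ʳ c≢0) (Coprime-sym (to (Coprime-division {q = monic w} ≃-refl) coprime))

  euclid-maps-to : ∀ m {x} → EuclidStep m x → MonicCoprime m (euclid m x)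
  euclid-maps-to m {x} step =
    length-resize m (dividend x) , length-resize m (divisor x) ,
    Coprime-resp-≃ (≃-sym (monic-resize m (dividend-monic x step))) (≃-sym (resize-≃ m (divisor-below x step)))
      (dividend-divisor-coprime x step)

  euclid-≃ : ∀ m x y → EuclidStep m x → EuclidStep m y → euclid m x ≡ euclid m y →
             dividend x ≃ dividend y × divisor x ≃ divisor y
  euclid-≃ m x y step step' eq =
    ≃-trans (≃-sym (monic-resize m (dividend-monic x step)))
      (≃-trans (≡⇒≃ (cong (monic ∘ proj₁) eq)) (monic-resize m (dividend-monic y step'))) ,
    ≃-trans (≃-sym (resize-≃ m (divisor-below x step)))
      (≃-trans (≡⇒≃ (cong proj₂ eq)) (resize-≃ m (divisor-below y step')))

  euclid-injective : ∀ m {x y} → EuclidStep m x → EuclidStep m y → euclid m x ≡ euclid m y → x ≡ y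
  euclid-injective m {x@(c , _ , w , v , s)} {y@(c' , _ , w' , v' , s')}
                   step@(c≢0 , _ , _ , refl , |s| , _) step'@(c'≢0 , _ , _ , refl , |s'| , _) eq
    with dividends , divisors ← euclid-≃ m x y step step' eq
    with refl , refl ← ·-monic-injective c≢0 c'≢0 divisors
    with w≃w' , s≃s' ← division-unique v (length≡⇒DegreeBelow s |s|) (length≡⇒DegreeBelow s' |s'|)
                                           dividends
    with refl ← monic-injective {w} {w'} w≃w'
    with refl ← ≃⇒≡ (trans |s| (sym |s'|)) s≃s'
    = refl

  euclid-preimage : ∀ m {F r c v} → MonicCoprime m (F , r) → c ≢ 0# → r ≃ c · monic v →
                    ∃ λ x → EuclidStep m x × euclid m x ≡ (F , r)
  euclid-preimage m {F} {r} {c} {v} (|F| , |r| , coprime) c≢0 r≃cv =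
    (c , k , w , v , remainder) ,
    (c≢0 , k<m , length-resize (m ∸ k) quotient , refl , length-remainder , coprime-v-remainder) ,
    cong₂ _,_ dividend≡F divisor≡r
    where
    k = length v
    k<m : k < m
    k<m = coef≉0⇒< (c≢0 ∘ ≈⇒≡ ∘ R.trans (R.sym (coef-·-monic-top c v)))
            (DegreeBelow-resp-≃ r≃cv (length≡⇒DegreeBelow r |r|))
    k≤m = Nat.<⇒≤ k<m

    open Division (divide v (suc m ∸ k) (monic F)
      (trans (length-monic F) (trans (cong suc |F|) (sym (Nat.m∸n+n≡m (Nat.m≤n⇒m≤1+n k≤m))))))

    quotient-monic : MonicOfDegree (m ∸ k) quotient
    quotient-monic = division-quotient-monic v
      (subst (λ n → MonicOfDegree n (monic F)) (trans |F| (sym (Nat.m∸n+n≡m k≤m))) (monic-MonicOfDegree F))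
      (length≡⇒DegreeBelow quotient (trans length-quotient (Nat.+-∸-assoc 1 k≤m)))
      (length≡⇒DegreeBelow remainder length-remainder)
      division

    w = resize (m ∸ k) quotient

    coprime-v-remainder : Coprime (monic v) remainder
    coprime-v-remainder = from (Coprime-division {q = quotient} {monic v} {remainder} division)
      (Coprime-sym (from (Coprime-·ʳ c≢0) (Coprime-resp-≃ ≃-refl r≃cv coprime)))

    dividend≡F : resize m (monic w ⊛ monic v ⊕ remainder) ≡ F
    dividend≡F = trans (resize-cong m dividend≃monic-F) (resize-monic F |F|)
      where
      dividend≃monic-F : monic w ⊛ monic v ⊕ remainder ≃ monic F
      dividend≃monic-F = ≃-trans (⊕-cong (⊛-congˡ (monic v) (monic-resize (m ∸ k) quotient-monic)) ≃-refl)
                                 (≃-sym division)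

    divisor≡r : resize m (c · monic v) ≡ r
    divisor≡r = trans (resize-cong m (≃-sym r≃cv)) (resize-length r |r|)

  euclid-onto : ∀ m {y} → 1 ≤ m → MonicCoprime m y → ∃ λ x → EuclidStep m x × euclid m x ≡ y
  euclid-onto m {F , r} 1≤m y-coprime@(|F| , _ , coprime) with zero-or-scaled-monic _≟_ r
  ... | inj₂ (c , v , c≢0 , r≃cv) = euclid-preimage m y-coprime c≢0 r≃cv
  ... | inj₁ r≃0 = ⊥-elim (monic-∤-one F (subst (1 ≤_) (sym |F|) 1≤m)
                     (coprime (monic F) (∣-refl (monic F)) (∣-resp-≃ {monic F} (≃-sym r≃0) (∣-[] (monic F)))))

  HasSize-MonicCoprime : ∀ m → HasSize (MonicCoprime m) (coprimeCount m)
  HasSize-MonicCoprime = <-rec _ step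
    where
    step : ∀ m → (∀ {k} → k < m → HasSize (MonicCoprime k) (coprimeCount k)) →
           HasSize (MonicCoprime m) (coprimeCount m)
    step zero _ = HasSize-⇔ only-empty (HasSize-singleton ([] , []))
      where
      only-empty : ∀ y → y ≡ ([] , []) ⇔ MonicCoprime 0 y
      only-empty ([] , [])    = mk⇔ (const (refl , refl , λ _ d∣1 _ → d∣1)) (const refl)
      only-empty ([] , _ ∷ _) = mk⇔ (λ ()) (λ ())
      only-empty (_ ∷ _ , _)  = mk⇔ (λ ()) (λ ())
    step (suc m) smaller =
      HasSize-size count
        (HasSize-image (euclid (suc m)) (euclid-injective (suc m)) (λ {x} → euclid-maps-to (suc m) {x})
           (euclid-onto (suc m) (s≤s z≤n))
          (HasSize-× HasSize-≢
            (HasSize-Σ< _ (suc m) λ k k<m → HasSize-× (HasSize-lists (suc m ∸ k)) (smaller k<m))))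
      where
      count : q-1 * ∑< (suc m) (λ k → q ^ (suc m ∸ k) * coprimeCount k) ≡ coprimeCount (suc m)
      count = cong (q-1 *_) (trans (∑<-weighted-coprimeCount m (suc m) (Nat.n<1+n m)) (cong (q ^_) (Nat.+-suc m m)))

module ReducedPairs (F : Field) (q-1 : ℕ) (Fin↔F : Fin (suc q-1) ↔ Field.Carrier F)
                    (t₁ t₂ : ℕ) (1≤t₁ : 1 ≤ t₁) (t₁≤t₂ : t₁ ≤ t₂) where
  open Field F using (Carrier; 0#; 1#)
  open Poly F
  open Polynomials F
  open FiniteType (suc q-1) Fin↔F using (HasSize-lists; _≟_)
  open CoprimePairs F q-1 Fin↔F using (q; coprimeCount; MonicCoprime; HasSize-MonicCoprime)

  Pair : Set
  Pair = Vec Carrier t₁ × Vec Carrier t₂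

  Reduced : Pair → Set
  Reduced (f₁ , f₂) = ReducedForm (toList f₁) (toList f₂)

  FirstZero : Pair → Set
  FirstZero (f₁ , _) = IsZero (toList f₁)

  toVec-≃ : ∀ {n} (f : Vec Carrier n) {g} → toList f ≃ g → toVec n g ≡ f
  toVec-≃ {n} f f≃g = trans (toVec-cong n (≃-sym f≃g)) (toVec-toList f)

  ReducedData : ℕ × Pol × Pol × Pol → Set
  ReducedData (m , w , v , s) = m < t₁ × length w ≡ t₂ ∸ m × MonicCoprime m (v , s)

  divisor dividend : ℕ × Pol × Pol × Pol → Pol
  divisor  (m , w , v , s) = monic v
  dividend (m , w , v , s) = w ⊛ monic v ⊕ s

  pair : ℕ × Pol × Pol × Pol → Pair
  pair x = toVec t₁ (divisor x) , toVec t₂ (dividend x)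

  pair-≃ : ∀ x → ReducedData x → toList (proj₁ (pair x)) ≃ divisor x × toList (proj₂ (pair x)) ≃ dividend x
  pair-≃ (m , w , v , s) (m<t₁ , |w| , refl , |s| , _) =
    resize-≃ t₁ (DegreeBelow-mono m<t₁ (proj₁ (monic-MonicOfDegree v))) ,
    resize-≃ t₂ (DegreeBelow-⊕ (subst (λ n → DegreeBelow n (w ⊛ monic v)) degree
                                  (DegreeBelow-⊛ (length≡⇒DegreeBelow w |w|) (proj₁ (monic-MonicOfDegree v))))
                               (DegreeBelow-mono (Nat.≤-trans (Nat.<⇒≤ m<t₁) t₁≤t₂) (length≡⇒DegreeBelow s |s|)))
    where
    degree : (t₂ ∸ length v) + length v ≡ t₂
    degree = Nat.m∸n+n≡m (Nat.≤-trans (Nat.<⇒≤ m<t₁) t₁≤t₂)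

  pair-maps-to : ∀ {x} → ReducedData x → ¬ FirstZero (pair x) × Reduced (pair x)
  pair-maps-to {x@(m , w , v , s)} x-data@(_ , _ , refl , _ , coprime) =
    nonzero , (λ _ → v , ≃⇒≐ f₁≃) , (λ z → ⊥-elim (nonzero z)) ,
    from IsGCD-one⇔Coprime
      (Coprime-resp-≃ (≃-sym f₁≃) (≃-sym f₂≃) (to (Coprime-division {q = w} ≃-refl) coprime))
    where
    f₁≃ = proj₁ (pair-≃ x x-data)
    f₂≃ = proj₂ (pair-≃ x x-data)
    nonzero : ¬ FirstZero (pair x)
    nonzero z = 1≉0 (R.trans (R.sym (proj₂ (monic-MonicOfDegree v)))
                      (R.trans (R.sym (coef-≈ f₁≃ (length v))) (coef-≈ (IsZero⇒≃[] z) (length v))))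

  pair-≃-pair : ∀ x y → ReducedData x → ReducedData y → pair x ≡ pair y →
                divisor x ≃ divisor y × dividend x ≃ dividend y
  pair-≃-pair x y x-data y-data eq =
    ≃-trans (≃-sym (proj₁ (pair-≃ x x-data)))
      (≃-trans (≡⇒≃ (cong (toList ∘ proj₁) eq)) (proj₁ (pair-≃ y y-data))) ,
    ≃-trans (≃-sym (proj₂ (pair-≃ x x-data)))
      (≃-trans (≡⇒≃ (cong (toList ∘ proj₂) eq)) (proj₂ (pair-≃ y y-data)))

  pair-injective : ∀ {x y} → ReducedData x → ReducedData y → pair x ≡ pair y → x ≡ y
  pair-injective {x@(_ , w , v , s)} {y@(_ , w' , v' , s')}
                 x-data@(_ , |w| , refl , |s| , _) y-data@(_ , |w'| , refl , |s'| , _) eq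
    with divisors , dividends ← pair-≃-pair x y x-data y-data eq
    with refl ← monic-injective {v} {v'} divisors
    with w≃w' , s≃s' ← division-unique v {w} {w'} {s} {s'}
                          (length≡⇒DegreeBelow s |s|) (length≡⇒DegreeBelow s' |s'|) dividends
    with refl ← ≃⇒≡ (trans |w| (sym |w'|)) w≃w'
    with refl ← ≃⇒≡ (trans |s| (sym |s'|)) s≃s'
    = refl

  pair-onto : ∀ {f} → ¬ FirstZero f × Reduced f → ∃ λ x → ReducedData x × pair x ≡ f
  pair-onto {f₁ , f₂} (nonzero , monic₁ , _ , gcd) =
    (length v , quotient , v , remainder) ,
    (|v|<t₁ , length-quotient , refl , length-remainder , coprime-v-remainder) ,
    cong₂ _,_ (toVec-≃ f₁ f₁≃monic-v) (toVec-≃ f₂ division)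
    where
    v = proj₁ (monic₁ nonzero)
    f₁≃monic-v : toList f₁ ≃ monic v
    f₁≃monic-v = ≐⇒≃ (proj₂ (monic₁ nonzero))
    |v|<t₁ : length v < t₁
    |v|<t₁ = coef≉0⇒< (1≉0 ∘ R.trans (R.sym (proj₂ (monic-MonicOfDegree v))))
               (DegreeBelow-resp-≃ f₁≃monic-v (length≡⇒DegreeBelow (toList f₁) (Vec.length-toList f₁)))
    open Division (divide v (t₂ ∸ length v) (toList f₂)
      (trans (Vec.length-toList f₂) (sym (Nat.m∸n+n≡m (Nat.≤-trans (Nat.<⇒≤ |v|<t₁) t₁≤t₂)))))
    coprime-v-remainder : Coprime (monic v) remainder
    coprime-v-remainder = from (Coprime-division {q = quotient} {monic v} {remainder} division)
      (Coprime-resp-≃ f₁≃monic-v ≃-refl (to IsGCD-one⇔Coprime gcd))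

  zero-pair : Pair
  zero-pair = toVec t₁ [] , toVec t₂ [ 1# ]

  zero-pair⇔FirstZero-Reduced : ∀ f → f ≡ zero-pair ⇔ (FirstZero f × Reduced f)
  zero-pair⇔FirstZero-Reduced (f₁ , f₂) = mk⇔ zero-pair-reduced only-zero-pair
    where
    one≃ : resize t₂ [ 1# ] ≃ [ 1# ]
    one≃ = resize-≃ t₂ (DegreeBelow-mono (Nat.≤-trans 1≤t₁ t₁≤t₂) (DegreeBelow-length [ 1# ]))
    zero-pair-reduced : (f₁ , f₂) ≡ zero-pair → FirstZero (f₁ , f₂) × Reduced (f₁ , f₂)
    zero-pair-reduced refl = first-zero , (λ nonzero → ⊥-elim (nonzero first-zero)) , (λ _ _ → [] , ≃⇒≐ one≃) ,
      from IsGCD-one⇔Coprime (λ d _ d∣f₂ → ∣-resp-≃ {d} one≃ d∣f₂)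
      where
      first-zero = ≃[]⇒IsZero (resize-≃ t₁ (vanishing λ _ _ → R.refl))
    only-zero-pair : FirstZero (f₁ , f₂) × Reduced (f₁ , f₂) → (f₁ , f₂) ≡ zero-pair
    only-zero-pair (first-zero , _ , monic₂ , gcd) =
      cong₂ _,_ (sym (toVec-≃ f₁ f₁≃0))
                (sym (toVec-≃ f₂ (subst (λ p → toList f₂ ≃ monic p) p≡[] f₂≃monic-p)))
      where
      coprime = to IsGCD-one⇔Coprime gcd
      f₁≃0 = IsZero⇒≃[] first-zero
      f₂-nonzero : ¬ IsZero (toList f₂)
      f₂-nonzero f₂-zero = ¬Coprime-[]-[] f₁≃0 (IsZero⇒≃[] f₂-zero) coprime
      p = proj₁ (monic₂ first-zero f₂-nonzero)
      f₂≃monic-p : toList f₂ ≃ monic p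
      f₂≃monic-p = ≐⇒≃ (proj₂ (monic₂ first-zero f₂-nonzero))
      p≡[] : p ≡ []
      p≡[] = Coprime-[]-monic p f₁≃0 (Coprime-resp-≃ ≃-refl f₂≃monic-p coprime)

  HasSize-Reduced : HasSize Reduced (∑< t₁ (λ m → q ^ (t₂ ∸ m) * coprimeCount m) + 1)
  HasSize-Reduced = HasSize-⇔ split (HasSize-⊎ (λ (nonzero , _) (first-zero , _) → nonzero first-zero)
    (HasSize-image pair pair-injective (λ {x} → pair-maps-to {x}) pair-onto
      (HasSize-Σ< _ t₁ λ m _ → HasSize-× (HasSize-lists (t₂ ∸ m)) (HasSize-MonicCoprime m)))
    (HasSize-⇔ zero-pair⇔FirstZero-Reduced (HasSize-singleton zero-pair)))
    where
    split : ∀ f → ((¬ FirstZero f × Reduced f) ⊎ (FirstZero f × Reduced f)) ⇔ Reduced f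
    split f = mk⇔ [ proj₂ , proj₂ ]′ classify
      where
      classify : Reduced f → (¬ FirstZero f × Reduced f) ⊎ (FirstZero f × Reduced f)
      classify reduced with All.all? (_≟ 0#) (toList (proj₁ f))
      ... | yes first-zero = inj₂ (first-zero , reduced)
      ... | no  nonzero    = inj₁ (nonzero , reduced)

lemma2p6 : (q : ℕ) (F : Field) → Fin q ↔ Field.Carrier F →
    (t₁ t₂ : ℕ) → 1 ≤ t₁ → t₁ ≤ t₂ →
    HasSize {Vec (Field.Carrier F) t₁ × Vec (Field.Carrier F) t₂}
      (λ { (f₁ , f₂) → Poly.ReducedForm F (toList f₁) (toList f₂) })
      (q ^ (t₁ + t₂ ∸ 1) + 1)
lemma2p6 zero F Fin↔F _ _ _ _ with Inverse.from Fin↔F (Field.0# F)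
... | ()
lemma2p6 (suc q-1) F Fin↔F (suc t) t₂ 1≤t₁ t₁≤t₂ =
  HasSize-size (cong (_+ 1) (∑<-weighted-coprimeCount t t₂ t₁≤t₂)) HasSize-Reduced
  where
  open CoprimePairs F q-1 Fin↔F using (∑<-weighted-coprimeCount)
  open ReducedPairs F q-1 Fin↔F (suc t) t₂ 1≤t₁ t₁≤t₂ using (HasSize-Reduced)
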